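{- Let $n\ge1$, let $1<k\le\lfloor\frac{n-1}2\rfloor$, and let $\Delta\subset B_n$ be a proper ideal (a simplicial complex on a subset of $[1,n]$ with $\emptyset\in\Delta$, $[1,n]\notin\Delta$). Then the Bier sphere $\mathrm{Bier}(\Delta)$ is a $k$-nearly neighborly $(n-2)$-sphere with $2n$ vertices if and only if (i) $A\in\Delta\Leftrightarrow[1,n]\setminus A\notin\Delta$ for all $A\subseteq[1,n]$, and (ii) $B\in\Delta$ for all $B\subseteq[1,n]$ with $|B|\le k$ (and thus $C\notin\Delta$ for all $C\subseteq[1,n]$ with $|C|\ge n-k$).
   Context: The Bier sphere $\mathrm{Bier}(\Delta)$ is the simplicial complex on the vertex set $\{v_i: \{i\}\in\Delta\}\cup\{w_j: [1,n]\setminus\{j\}\notin\Delta\}$ whose faces are the sets $\{v_i: i\in B\}\cup\{w_j: j\in[1,n]\setminus C\}$ for all $B\subseteq C\subseteq[1,n]$ with $B\in\Delta$, $C\notin\Delta$; it is a PL $(n-2)$-sphere. A simplicial complex $\Gamma$ with vertex set $V$ is centrally symmetric if there is a fixed-point-free involution $\alpha$ on $V$ such that $\alpha(F)$ is a face for every face $F$, and $\{x,\alpha(x)\}$ is not a face for every $x\in V$. A subset $A\subseteq V$ is antipode-free if it contains no pair $\{x,\alpha(x)\}$. A centrally symmetric $\Gamma$ is $k$-nearly neighborly if every antipode-free set $A\subseteq V$ with $|A|\le k$ is a face of $\Gamma$ (for $k\ge2$ the involution is uniquely determined by $\{x,\alpha(x)\}\notin\Gamma$). -}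

module Defs where

open import Data.Bool using (Bool; true; false; not)
open import Data.Nat using (ℕ; _≤_; _+_)
open import Data.Fin using (Fin)
open import Data.Fin.Subset using (Subset; _⊆_; _∈_; _∉_; ⁅_⁆; ∁; ⊥; ⊤; ∣_∣)
open import Data.Vec using (tabulate)
open import Data.List using (List; []; _∷_; map; length)
import Data.List.Membership.Propositional as LM
open import Data.List.Relation.Unary.Any using (Any)
open import Data.List.Relation.Unary.Unique.Propositional using (Unique)
open import Data.Product using (Σ; ∃; ∃-syntax; _×_; proj₁)
open import Function.Bundles using (_⇔_)
open import Relation.Binary.PropositionalEquality using (_≡_; _≢_)
open import Relation.Nullary using (¬_)
open import Data.Empty using () renaming (⊥ to Empty)

Family : ℕ → Set
Family n = Subset n → Bool

record IsProperIdeal {n : ℕ} (Δ : Family n) : Set where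
  field
    downClosed : ∀ {A B : Subset n} → A ⊆ B → Δ B ≡ true → Δ A ≡ true
    emptyIn    : Δ ⊥ ≡ true
    fullNotIn  : Δ ⊤ ≡ false

-- Generic notions for a simplicial complex with vertex type V whose faces
-- are given by a predicate on finite vertex sets (represented as lists;
-- a list stands for the set of its elements).

module _ {V : Set} (Face : List V → Set) where

  IsCSInvolution : (V → V) → Set
  IsCSInvolution α =
    (∀ x → α x ≢ x) ×
    (∀ x → α (α x) ≡ x) ×
    (∀ F → Face F → Face (map α F)) ×
    (∀ x → ¬ Face (x ∷ α x ∷ []))

  CentrallySymmetric : Set
  CentrallySymmetric = ∃[ α ] IsCSInvolution α

  AntipodeFree : (V → V) → List V → Set
  AntipodeFree α A = ∀ x → x LM.∈ A → α x LM.∈ A → Empty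

  NearlyNeighborly : ℕ → Set
  NearlyNeighborly k = ∃[ α ] (IsCSInvolution α ×
    (∀ (A : List V) → Unique A → length A ≤ k → AntipodeFree α A → Face A))

data BVert (n : ℕ) : Set where
  v : Fin n → BVert n
  w : Fin n → BVert n

isVertex : {n : ℕ} → Family n → BVert n → Bool
isVertex Δ (v i) = Δ ⁅ i ⁆
isVertex Δ (w j) = not (Δ (∁ ⁅ j ⁆))

Vert : {n : ℕ} → Family n → Set
Vert Δ = Σ (BVert _) (λ x → isVertex Δ x ≡ true)

numVertices : {n : ℕ} → Family n → ℕ
numVertices {n} Δ =
  ∣ tabulate (λ i → isVertex Δ (v i)) ∣ + ∣ tabulate (λ j → isVertex Δ (w j)) ∣

_∈ᵥ_ : {n : ℕ} {Δ : Family n} → BVert n → List (Vert Δ) → Set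
x ∈ᵥ F = Any (λ y → proj₁ y ≡ x) F

BierFace : {n : ℕ} (Δ : Family n) → List (Vert Δ) → Set
BierFace {n} Δ F = ∃[ B ] ∃[ C ]
  (Δ B ≡ true × Δ C ≡ false × B ⊆ C ×
   (∀ (i : Fin n) → (v i ∈ᵥ F) ⇔ (i ∈ B)) ×
   (∀ (j : Fin n) → (w j ∈ᵥ F) ⇔ (j ∉ C)))

{-# OPTIONS --safe #-}
module Submission where

-- Once Bier(Δ) has all 2n vertices, no face contains both v i and w i, so for k ≥ 2 the
-- involution of a k-nearly neighborly Bier sphere must be the antipode v i ↔ w i.
-- A vertex list whose v-vertices have indices B and whose w-vertices have indices W is
-- a face iff B ∈ Δ, [1,n] ∖ W ∉ Δ and B ∩ W = ∅; the antipode exchanges B and W.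
-- Testing this on {v i : i ∈ A} and its antipode shows that faces are closed under the
-- antipode iff Δ is self-dual (i). Given (i), an antipode-free list of length ≤ k has
-- |B|, |W| ≤ k, so it is a face when (ii) holds; conversely {v i : i ∈ B} is antipode-free,
-- so k-nearly neighborliness forces (ii).

open import Defs
open import Data.Bool using (Bool; true; false)
import Data.Bool as Bool
open import Data.Nat using (ℕ; suc; _≤_; _<_; _*_; _∸_; _/_; _+_; s≤s)
open import Data.Nat.Properties
  using ( ≤-antisym; ≤-trans; ≤-reflexive; <⇒≤; +-cancelʳ-≤; +-monoʳ-≤; +-comm; +-identityʳ
        ; m≤n⇒m≤1+n; module ≤-Reasoning)
open import Data.Fin using (Fin; zero; suc)
import Data.Fin.Properties as Fin
open import Data.Fin.Subset
  using (Subset; inside; outside; _⊆_; _∈_; ⁅_⁆; ∁; ⊥; ⊤; _∪_; ∣_∣)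
open import Data.Fin.Subset.Properties
  using ( _∈?_; ∉⊥; ∈⊤; ⊆⊤; ⊆-antisym; ∣p∣≤n; ∣⊥∣≡0; ∣⊤∣≡n; ∣p∣≡n⇒p≡⊤; ∣⁅x⁆∣≡1; ∣p∣≤∣x∷p∣
        ; x∈⁅x⁆; x∈⁅y⁆⇒x≡y; ∪-identityˡ; x∈p∪q⁺; x∈p∪q⁻
        ; x∈p⇒x∉∁p; x∈∁p⇒x∉p; x∉∁p⇒x∈p; x∉p⇒x∈∁p)
open import Data.Vec using (tabulate; []; _∷_; here; there)
open import Data.Vec.Properties using (lookup∘tabulate; []=⇒lookup; lookup⇒[]=)
open import Data.List using (List; []; _∷_; map; length)
open import Data.List.Properties using (map-cong; length-map)
import Data.List.Membership.Propositional as List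
open import Data.List.Membership.Propositional.Properties using (∈-map⁺; ∈-map⁻)
open import Data.List.Relation.Unary.Any as Any using (here; there)
import Data.List.Relation.Unary.Any.Properties as Any
import Data.List.Relation.Unary.All as All
import Data.List.Relation.Unary.All.Properties as All
open import Data.List.Relation.Unary.AllPairs using ([]; _∷_)
open import Data.List.Relation.Unary.Unique.Propositional using (Unique)
import Data.List.Relation.Unary.Unique.Propositional.Properties as Unique
open import Data.Product using (_×_; _,_; proj₁; proj₂)
open import Data.Sum using (inj₁; inj₂)
open import Data.Empty using (⊥-elim) renaming (⊥ to Empty)
open import Function using (_∘_; case_of_)
open import Function.Bundles using (_⇔_; mk⇔; Equivalence)
import Function.Properties.Equivalence as ⇔
open import Relation.Binary.Definitions using (DecidableEquality)
open import Relation.Binary.PropositionalEquality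
  using (_≡_; _≢_; refl; sym; trans; cong; cong₂; subst; _≗_; module ≡-Reasoning)
open import Relation.Nullary using (¬_; yes; no)
open import Relation.Nullary.Decidable using (map′; decidable-stable)
open import Axiom.UniquenessOfIdentityProofs using (module Decidable⇒UIP)

open Equivalence using (to; from)

m+n≡o+o⇒m≡o : ∀ {m n o} → m ≤ o → n ≤ o → m + n ≡ o + o → m ≡ o
m+n≡o+o⇒m≡o {m} {n} {o} m≤o n≤o m+n≡o+o = ≤-antisym m≤o (+-cancelʳ-≤ n o m (begin
  o + n ≤⟨ +-monoʳ-≤ o n≤o ⟩
  o + o ≡⟨ sym m+n≡o+o ⟩
  m + n ∎))
  where open ≤-Reasoning

∈-tabulate : ∀ {m} {f : Fin m → Bool} {i} → i ∈ tabulate f ⇔ f i ≡ true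
∈-tabulate {f = f} {i} = mk⇔
  (λ i∈ → trans (sym (lookup∘tabulate f i)) ([]=⇒lookup i∈))
  (λ fi≡true → lookup⇒[]= i _ (trans (lookup∘tabulate f i) fi≡true))

∣tabulate∣≡m⇔all : ∀ {m} (f : Fin m → Bool) → ∣ tabulate f ∣ ≡ m ⇔ (∀ i → f i ≡ true)
∣tabulate∣≡m⇔all {m} f = mk⇔
  (λ full i → to ∈-tabulate (subst (i ∈_) (sym (∣p∣≡n⇒p≡⊤ full)) ∈⊤))
  (λ all → trans (cong ∣_∣ (⊆-antisym ⊆⊤ (λ {i} _ → from ∈-tabulate (all i)))) (∣⊤∣≡n m))

∣⁅x⁆∪p∣≤1+∣p∣ : ∀ {m} (i : Fin m) (p : Subset m) → ∣ ⁅ i ⁆ ∪ p ∣ ≤ suc ∣ p ∣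
∣⁅x⁆∪p∣≤1+∣p∣ zero    (b ∷ p)       =
  s≤s (≤-trans (≤-reflexive (cong ∣_∣ (∪-identityˡ p))) (∣p∣≤∣x∷p∣ b p))
∣⁅x⁆∪p∣≤1+∣p∣ (suc i) (outside ∷ p) = ∣⁅x⁆∪p∣≤1+∣p∣ i p
∣⁅x⁆∪p∣≤1+∣p∣ (suc i) (inside ∷ p)  = s≤s (∣⁅x⁆∪p∣≤1+∣p∣ i p)

∁⊥≡⊤ : ∀ {m} → ∁ (⊥ {m}) ≡ ⊤
∁⊥≡⊤ = ⊆-antisym ⊆⊤ (λ _ → x∉p⇒x∈∁p ∉⊥)

p⊆∁q⇒q⊆∁p : ∀ {m} {p q : Subset m} → p ⊆ ∁ q → q ⊆ ∁ p
p⊆∁q⇒q⊆∁p p⊆∁q i∈q = x∉p⇒x∈∁p (λ i∈p → x∈∁p⇒x∉p (p⊆∁q i∈p) i∈q)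

toList : ∀ {m} → Subset m → List (Fin m)
toList []            = []
toList (inside ∷ p)  = zero ∷ map suc (toList p)
toList (outside ∷ p) = map suc (toList p)

∈-toList⁻ : ∀ {m} {p : Subset m} {i} → i List.∈ toList p → i ∈ p
∈-toList⁻ {p = inside ∷ _} (here refl) = here
∈-toList⁻ {p = inside ∷ _} (there i∈)
  with j , j∈ , refl ← ∈-map⁻ suc i∈ = there (∈-toList⁻ j∈)
∈-toList⁻ {p = outside ∷ _} i∈
  with j , j∈ , refl ← ∈-map⁻ suc i∈ = there (∈-toList⁻ j∈)

∈-toList⁺ : ∀ {m} {p : Subset m} {i} → i ∈ p → i List.∈ toList p
∈-toList⁺ {p = inside ∷ _}  here       = here refl
∈-toList⁺ {p = inside ∷ _}  (there i∈) = there (∈-map⁺ suc (∈-toList⁺ i∈))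
∈-toList⁺ {p = outside ∷ _} (there i∈) = ∈-map⁺ suc (∈-toList⁺ i∈)

∈-toList : ∀ {m} {p : Subset m} {i} → i List.∈ toList p ⇔ i ∈ p
∈-toList = mk⇔ ∈-toList⁻ ∈-toList⁺

length-toList : ∀ {m} (p : Subset m) → length (toList p) ≡ ∣ p ∣
length-toList []            = refl
length-toList (inside ∷ p)  = cong suc (trans (length-map suc (toList p)) (length-toList p))
length-toList (outside ∷ p) = trans (length-map suc (toList p)) (length-toList p)

toList-Unique : ∀ {m} (p : Subset m) → Unique (toList p)
toList-Unique []            = []
toList-Unique (inside ∷ p)  =
  All.map⁺ (All.universal (λ _ ()) (toList p)) ∷ Unique.map⁺ Fin.suc-injective (toList-Unique p)
toList-Unique (outside ∷ p) = Unique.map⁺ Fin.suc-injective (toList-Unique p)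

opposite : ∀ {n} → BVert n → BVert n
opposite (v i) = w i
opposite (w j) = v j

opposite-involutive : ∀ {n} (x : BVert n) → opposite (opposite x) ≡ x
opposite-involutive (v _) = refl
opposite-involutive (w _) = refl

opposite[x]≢x : ∀ {n} (x : BVert n) → opposite x ≢ x
opposite[x]≢x (v _) ()
opposite[x]≢x (w _) ()

v-injective : ∀ {n} {i j : Fin n} → v i ≡ v j → i ≡ j
v-injective refl = refl

w-injective : ∀ {n} {i j : Fin n} → w i ≡ w j → i ≡ j
w-injective refl = refl

_≟ᴮ_ : ∀ {n} → DecidableEquality (BVert n)
v i ≟ᴮ v j = map′ (cong v) v-injective (i Fin.≟ j)
w i ≟ᴮ w j = map′ (cong w) w-injective (i Fin.≟ j)
v _ ≟ᴮ w _ = no λ ()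
w _ ≟ᴮ v _ = no λ ()

NearlyNeighborlyVia : {V : Set} → (List V → Set) → (V → V) → ℕ → Set
NearlyNeighborlyVia {V} Face α k =
  ∀ (A : List V) → Unique A → length A ≤ k → AntipodeFree Face α A → Face A

module _ {n : ℕ} (Δ : Family n) where

  SelfDual : Set
  SelfDual = ∀ (A : Subset n) → (Δ A ≡ true) ⇔ (Δ (∁ A) ≡ false)

  ContainsAll≤ : ℕ → Set
  ContainsAll≤ k = ∀ (B : Subset n) → ∣ B ∣ ≤ k → Δ B ≡ true

  AllVertices : Set
  AllVertices = ∀ x → isVertex Δ x ≡ true

  numVertices≡2n⇔AllVertices : numVertices Δ ≡ 2 * n ⇔ AllVertices
  numVertices≡2n⇔AllVertices = mk⇔ allPresent countAll
    where
    vFlags wFlags : Subset n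
    vFlags = tabulate (isVertex Δ ∘ v)
    wFlags = tabulate (isVertex Δ ∘ w)

    2n≡n+n : 2 * n ≡ n + n
    2n≡n+n = cong (n +_) (+-identityʳ n)

    allPresent : ∣ vFlags ∣ + ∣ wFlags ∣ ≡ 2 * n → AllVertices
    allPresent total (v i) = to (∣tabulate∣≡m⇔all (isVertex Δ ∘ v)) ∣vFlags∣≡n i
      where
      ∣vFlags∣≡n : ∣ vFlags ∣ ≡ n
      ∣vFlags∣≡n = m+n≡o+o⇒m≡o (∣p∣≤n vFlags) (∣p∣≤n wFlags) (trans total 2n≡n+n)
    allPresent total (w j) = to (∣tabulate∣≡m⇔all (isVertex Δ ∘ w)) ∣wFlags∣≡n j
      where
      ∣wFlags∣≡n : ∣ wFlags ∣ ≡ n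
      ∣wFlags∣≡n = m+n≡o+o⇒m≡o (∣p∣≤n wFlags) (∣p∣≤n vFlags)
        (trans (+-comm ∣ wFlags ∣ ∣ vFlags ∣) (trans total 2n≡n+n))

    countAll : AllVertices → ∣ vFlags ∣ + ∣ wFlags ∣ ≡ 2 * n
    countAll all = trans
      (cong₂ _+_ (from (∣tabulate∣≡m⇔all _) (all ∘ v)) (from (∣tabulate∣≡m⇔all _) (all ∘ w)))
      (sym 2n≡n+n)

  SelfDual∧ContainsAll≤⇒AllVertices : ∀ {k} → 1 ≤ k → SelfDual → ContainsAll≤ k → AllVertices
  SelfDual∧ContainsAll≤⇒AllVertices 1≤k selfDual small (v i) =
    small ⁅ i ⁆ (subst (_≤ _) (sym (∣⁅x⁆∣≡1 i)) 1≤k)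
  SelfDual∧ContainsAll≤⇒AllVertices 1≤k selfDual small (w j) =
    cong Bool.not (to (selfDual ⁅ j ⁆) (SelfDual∧ContainsAll≤⇒AllVertices 1≤k selfDual small (v j)))

  IndexSets : List (Vert Δ) → Subset n → Subset n → Set
  IndexSets F B W = (∀ i → v i ∈ᵥ F ⇔ i ∈ B) × (∀ j → w j ∈ᵥ F ⇔ j ∈ W)

  BierPair : Subset n → Subset n → Set
  BierPair B W = Δ B ≡ true × Δ (∁ W) ≡ false × B ⊆ ∁ W

  BierFace⇔BierPair : ∀ {F B W} → IndexSets F B W → BierFace Δ F ⇔ BierPair B W
  BierFace⇔BierPair {F} {B} {W} (vB , wW) = mk⇔ bierPair bierFace
    where
    bierFace : BierPair B W → BierFace Δ F
    bierFace (B∈Δ , ∁W∉Δ , B⊆∁W) =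
      B , ∁ W , B∈Δ , ∁W∉Δ , B⊆∁W , vB ,
      λ j → mk⇔ (x∈p⇒x∉∁p ∘ to (wW j)) (from (wW j) ∘ x∉∁p⇒x∈p)

    bierPair : BierFace Δ F → BierPair B W
    bierPair (B′ , C , B′∈Δ , C∉Δ , B′⊆C , vB′ , wC) =
      subst (λ X → Δ X ≡ true) B′≡B B′∈Δ ,
      subst (λ X → Δ X ≡ false) C≡∁W C∉Δ ,
      subst (B ⊆_) C≡∁W (λ {i} → B′⊆C ∘ to (vB′ i) ∘ from (vB i))
      where
      B′≡B : B′ ≡ B
      B′≡B = ⊆-antisym (λ {i} → to (vB i) ∘ from (vB′ i)) (λ {i} → to (vB′ i) ∘ from (vB i))

      C≡∁W : C ≡ ∁ W
      C≡∁W = ⊆-antisym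
        (λ {j} j∈C → x∉p⇒x∈∁p λ j∈W → to (wC j) (from (wW j) j∈W) j∈C)
        (λ {j} j∈∁W → decidable-stable (j ∈? C) λ j∉C →
          x∈∁p⇒x∉p j∈∁W (to (wW j) (from (wC j) j∉C)))

  antipodal-nonFace : ∀ x {F} → x ∈ᵥ F → opposite x ∈ᵥ F → ¬ BierFace Δ F
  antipodal-nonFace (v i) vi∈F wi∈F (_ , _ , _ , _ , B⊆C , vB , wC) =
    to (wC i) wi∈F (B⊆C (to (vB i) vi∈F))
  antipodal-nonFace (w i) wi∈F vi∈F = antipodal-nonFace (v i) vi∈F wi∈F

  vIndices : List (Vert Δ) → Subset n
  vIndices []              = ⊥
  vIndices ((v i , _) ∷ F) = ⁅ i ⁆ ∪ vIndices F
  vIndices ((w _ , _) ∷ F) = vIndices F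

  ∈-vIndices⁻ : ∀ F {i} → i ∈ vIndices F → v i ∈ᵥ F
  ∈-vIndices⁻ []              i∈ = ⊥-elim (∉⊥ i∈)
  ∈-vIndices⁻ ((v j , _) ∷ F) i∈ with x∈p∪q⁻ ⁅ j ⁆ (vIndices F) i∈
  ... | inj₁ i∈⁅j⁆ = here (cong v (sym (x∈⁅y⁆⇒x≡y j i∈⁅j⁆)))
  ... | inj₂ i∈F   = there (∈-vIndices⁻ F i∈F)
  ∈-vIndices⁻ ((w _ , _) ∷ F) i∈ = there (∈-vIndices⁻ F i∈)

  ∈-vIndices⁺ : ∀ F {i} → v i ∈ᵥ F → i ∈ vIndices F
  ∈-vIndices⁺ ((v j , _) ∷ F) (here refl) = x∈p∪q⁺ (inj₁ (x∈⁅x⁆ j))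
  ∈-vIndices⁺ ((v j , _) ∷ F) (there vi∈) = x∈p∪q⁺ (inj₂ (∈-vIndices⁺ F vi∈))
  ∈-vIndices⁺ ((w _ , _) ∷ F) (there vi∈) = ∈-vIndices⁺ F vi∈

  ∈-vIndices : ∀ {F i} → i ∈ vIndices F ⇔ v i ∈ᵥ F
  ∈-vIndices {F} = mk⇔ (∈-vIndices⁻ F) (∈-vIndices⁺ F)

  ∣vIndices∣≤length : ∀ F → ∣ vIndices F ∣ ≤ length F
  ∣vIndices∣≤length []              = ≤-reflexive (∣⊥∣≡0 n)
  ∣vIndices∣≤length ((v i , _) ∷ F) =
    ≤-trans (∣⁅x⁆∪p∣≤1+∣p∣ i (vIndices F)) (s≤s (∣vIndices∣≤length F))
  ∣vIndices∣≤length ((w _ , _) ∷ F) = m≤n⇒m≤1+n (∣vIndices∣≤length F)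

  module _ (allVertices : AllVertices) where

    vertex : BVert n → Vert Δ
    vertex x = x , allVertices x

    proj₁-injective : ∀ {x y : Vert Δ} → proj₁ x ≡ proj₁ y → x ≡ y
    proj₁-injective {x , p} {.x , q} refl = cong (x ,_) (Decidable⇒UIP.≡-irrelevant Bool._≟_ p q)

    antipode : Vert Δ → Vert Δ
    antipode x = vertex (opposite (proj₁ x))

    ∈ᵥ-map-antipode : ∀ {x F} → x ∈ᵥ map antipode F ⇔ opposite x ∈ᵥ F
    ∈ᵥ-map-antipode {x} = mk⇔
      (Any.map (λ {y} ōy≡x → trans (sym (opposite-involutive (proj₁ y))) (cong opposite ōy≡x))
        ∘ Any.map⁻)
      (Any.map⁺ ∘ Any.map (λ y≡ōx → trans (cong opposite y≡ōx) (opposite-involutive x)))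

    IndexSets-map-antipode : ∀ {F B W} → IndexSets F B W → IndexSets (map antipode F) W B
    IndexSets-map-antipode (vB , wW) =
      (λ i → ⇔.trans ∈ᵥ-map-antipode (wW i)) , (λ j → ⇔.trans ∈ᵥ-map-antipode (vB j))

    wIndices : List (Vert Δ) → Subset n
    wIndices F = vIndices (map antipode F)

    ∣wIndices∣≤length : ∀ F → ∣ wIndices F ∣ ≤ length F
    ∣wIndices∣≤length F =
      ≤-trans (∣vIndices∣≤length (map antipode F)) (≤-reflexive (length-map antipode F))

    IndexSets-indices : ∀ F → IndexSets F (vIndices F) (wIndices F)
    IndexSets-indices F =
      (λ i → ⇔.sym ∈-vIndices) , (λ j → ⇔.sym (⇔.trans ∈-vIndices ∈ᵥ-map-antipode))

    antipodeFree-∈ᵥ : ∀ {F} → AntipodeFree (BierFace Δ) antipode F →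
                      ∀ x → x ∈ᵥ F → opposite x ∈ᵥ F → Empty
    antipodeFree-∈ᵥ {F} antipodeFree x x∈F ōx∈F
      with y , y∈F , refl ← List.find x∈F | z , z∈F , z≡ōy ← List.find ōx∈F =
      antipodeFree y y∈F (subst (List._∈ F) (proj₁-injective z≡ōy) z∈F)

    vVertices : Subset n → List (Vert Δ)
    vVertices A = map (vertex ∘ v) (toList A)

    IndexSets-vVertices : ∀ A → IndexSets (vVertices A) A ⊥
    IndexSets-vVertices A =
      (λ i → mk⇔ (to ∈-toList ∘ Any.map (sym ∘ v-injective) ∘ Any.map⁻)
                 (Any.map⁺ ∘ Any.map (cong v ∘ sym) ∘ from ∈-toList)) ,
      (λ j → mk⇔ (λ wj∈ → case proj₂ (Any.satisfied (Any.map⁻ wj∈)) of λ ())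
                 (⊥-elim ∘ ∉⊥))

    NearlyNeighborlyVia⇒≗antipode : ∀ {α k} → 1 < k → IsCSInvolution (BierFace Δ) α →
                                    NearlyNeighborlyVia (BierFace Δ) α k → α ≗ antipode
    NearlyNeighborlyVia⇒≗antipode {α} 1<k (fixpointFree , involutive , _ , _) nearlyNeighborly x
      with proj₁ (α x) ≟ᴮ opposite (proj₁ x)
    ... | yes αx≈ōx = proj₁-injective αx≈ōx
    ... | no αx≉ōx  = ⊥-elim (antipodal-nonFace (proj₁ x) (here refl) (there (here refl))
                               (nearlyNeighborly pair unique 1<k antipodeFree))
      where
      pair : List (Vert Δ)
      pair = x ∷ antipode x ∷ []

      unique : Unique pair
      unique = ((λ x≡ōx → opposite[x]≢x (proj₁ x) (sym (cong proj₁ x≡ōx))) All.∷ All.[])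
             ∷ (All.[] ∷ [])

      antipodeFree : AntipodeFree (BierFace Δ) α pair
      antipodeFree _ (here refl)         (here αx≡x)           = fixpointFree x αx≡x
      antipodeFree _ (here refl)         (there (here αx≡ōx))  = αx≉ōx (cong proj₁ αx≡ōx)
      antipodeFree _ (there (here refl)) (here αōx≡x)          = αx≉ōx (cong proj₁ (begin
        α x                ≡⟨ cong α αōx≡x ⟨
        α (α (antipode x)) ≡⟨ involutive (antipode x) ⟩
        antipode x         ∎))
        where open ≡-Reasoning
      antipodeFree _ (there (here refl)) (there (here αōx≡ōx)) = fixpointFree (antipode x) αōx≡ōx

    antipode-closed⇒SelfDual : Δ ⊥ ≡ true → Δ ⊤ ≡ false →
                               (∀ F → BierFace Δ F → BierFace Δ (map antipode F)) → SelfDual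
    antipode-closed⇒SelfDual ∅∈Δ ⊤∉Δ antipode-closed A = mk⇔ A∈Δ⇒∁A∉Δ ∁A∉Δ⇒A∈Δ
      where
      vA : IndexSets (vVertices A) A ⊥
      vA = IndexSets-vVertices A

      wA : IndexSets (map antipode (vVertices A)) ⊥ A
      wA = IndexSets-map-antipode vA

      A∈Δ⇒∁A∉Δ : Δ A ≡ true → Δ (∁ A) ≡ false
      A∈Δ⇒∁A∉Δ A∈Δ = proj₁ (proj₂ (to (BierFace⇔BierPair wA) (antipode-closed _
        (from (BierFace⇔BierPair vA)
          (A∈Δ , subst (λ X → Δ X ≡ false) (sym ∁⊥≡⊤) ⊤∉Δ , λ _ → x∉p⇒x∈∁p ∉⊥)))))

      ∁A∉Δ⇒A∈Δ : Δ (∁ A) ≡ false → Δ A ≡ true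
      ∁A∉Δ⇒A∈Δ ∁A∉Δ = proj₁ (to (BierFace⇔BierPair (IndexSets-map-antipode wA)) (antipode-closed _
        (from (BierFace⇔BierPair wA) (∅∈Δ , ∁A∉Δ , ⊥-elim ∘ ∉⊥))))

    NearlyNeighborlyVia⇒ContainsAll≤ : ∀ {α k} → α ≗ antipode →
                                       NearlyNeighborlyVia (BierFace Δ) α k → ContainsAll≤ k
    NearlyNeighborlyVia⇒ContainsAll≤ {α} {k} α≗antipode nearlyNeighborly B ∣B∣≤k =
      proj₁ (to (BierFace⇔BierPair (IndexSets-vVertices B))
        (nearlyNeighborly (vVertices B) unique length≤k antipodeFree))
      where
      unique : Unique (vVertices B)
      unique = Unique.map⁺ (v-injective ∘ cong proj₁) (toList-Unique B)

      length≤k : length (vVertices B) ≤ k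
      length≤k = subst (_≤ k) (sym (trans (length-map _ (toList B)) (length-toList B))) ∣B∣≤k

      antipodeFree : AntipodeFree (BierFace Δ) α (vVertices B)
      antipodeFree x x∈ αx∈
        with _ , _ , refl ← ∈-map⁻ (vertex ∘ v) x∈
           | _ , _ , ōx≡vj ← ∈-map⁻ (vertex ∘ v) (subst (List._∈ vVertices B) (α≗antipode x) αx∈) =
        case cong proj₁ ōx≡vj of λ ()

    SelfDual⇒antipode-closed : SelfDual → ∀ F → BierFace Δ F → BierFace Δ (map antipode F)
    SelfDual⇒antipode-closed selfDual F face
      with B∈Δ , ∁W∉Δ , B⊆∁W ← to (BierFace⇔BierPair (IndexSets-indices F)) face =
      from (BierFace⇔BierPair (IndexSets-map-antipode (IndexSets-indices F)))
        (from (selfDual (wIndices F)) ∁W∉Δ , to (selfDual (vIndices F)) B∈Δ , p⊆∁q⇒q⊆∁p B⊆∁W)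

    SelfDual⇒antipode-IsCSInvolution : SelfDual → IsCSInvolution (BierFace Δ) antipode
    SelfDual⇒antipode-IsCSInvolution selfDual =
      (λ x ōx≡x → opposite[x]≢x (proj₁ x) (cong proj₁ ōx≡x)) ,
      (λ x → proj₁-injective (opposite-involutive (proj₁ x))) ,
      SelfDual⇒antipode-closed selfDual ,
      (λ x → antipodal-nonFace (proj₁ x) (here refl) (there (here refl)))

    antipode-NearlyNeighborlyVia : ∀ {k} → SelfDual → ContainsAll≤ k →
                                   NearlyNeighborlyVia (BierFace Δ) antipode k
    antipode-NearlyNeighborlyVia selfDual small F _ ∣F∣≤k antipodeFree =
      from (BierFace⇔BierPair (IndexSets-indices F))
        ( small (vIndices F) (≤-trans (∣vIndices∣≤length F) ∣F∣≤k)
        , to (selfDual (wIndices F)) (small (wIndices F) (≤-trans (∣wIndices∣≤length F) ∣F∣≤k))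
        , λ {i} i∈B → x∉p⇒x∈∁p λ i∈W → antipodeFree-∈ᵥ antipodeFree (v i)
            (from (proj₁ (IndexSets-indices F) i) i∈B) (from (proj₂ (IndexSets-indices F) i) i∈W))

proposition6p2 : (n k : ℕ) (Δ : Family n) →
    1 ≤ n → 1 < k → k ≤ (n ∸ 1) / 2 → IsProperIdeal Δ →
    ((NearlyNeighborly (BierFace Δ) k × numVertices Δ ≡ 2 * n)
      ⇔
     ((∀ (A : Subset n) → (Δ A ≡ true) ⇔ (Δ (∁ A) ≡ false)) ×
      (∀ (B : Subset n) → ∣ B ∣ ≤ k → Δ B ≡ true)))
proposition6p2 n k Δ _ 1<k _ properIdeal = mk⇔ necessary sufficient
  where
  open IsProperIdeal properIdeal

  necessary : NearlyNeighborly (BierFace Δ) k × numVertices Δ ≡ 2 * n →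
              SelfDual Δ × ContainsAll≤ Δ k
  necessary ((α , csInvolution@(_ , _ , α-closed , _) , nearlyNeighborly) , 2n-vertices) =
    antipode-closed⇒SelfDual Δ allVertices emptyIn fullNotIn antipode-closed ,
    NearlyNeighborlyVia⇒ContainsAll≤ Δ allVertices α≗antipode nearlyNeighborly
    where
    allVertices : AllVertices Δ
    allVertices = to (numVertices≡2n⇔AllVertices Δ) 2n-vertices

    α≗antipode : α ≗ antipode Δ allVertices
    α≗antipode = NearlyNeighborlyVia⇒≗antipode Δ allVertices 1<k csInvolution nearlyNeighborly

    antipode-closed : ∀ F → BierFace Δ F → BierFace Δ (map (antipode Δ allVertices) F)
    antipode-closed F face = subst (BierFace Δ) (map-cong α≗antipode F) (α-closed F face)

  sufficient : SelfDual Δ × ContainsAll≤ Δ k →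
               NearlyNeighborly (BierFace Δ) k × numVertices Δ ≡ 2 * n
  sufficient (selfDual , small) =
    (antipode Δ allVertices ,
     SelfDual⇒antipode-IsCSInvolution Δ allVertices selfDual ,
     antipode-NearlyNeighborlyVia Δ allVertices selfDual small) ,
    from (numVertices≡2n⇔AllVertices Δ) allVertices
    where
    allVertices : AllVertices Δ
    allVertices = SelfDual∧ContainsAll≤⇒AllVertices Δ (<⇒≤ 1<k) selfDual small
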